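{- For an integer $k\ge 1$, let $n_k=2^{2^k-1}$. Then $n_k$ is super-imperfect, i.e. $2\beta(\beta(n_k))=n_k$, if and only if $k\in\{1,2,3,4,5\}$.
   Context: $\beta$ denotes the alternating sum-of-divisors function: the multiplicative arithmetic function with $\beta(1)=1$ and $\beta(p^a)=p^a-p^{a-1}+p^{a-2}-\cdots+(-1)^a$ for every prime power $p^a$ ($a\ge 1$); equivalently $\beta(n)=\sum_{d\mid n} d\,\lambda(n/d)$, where $\lambda(n)=(-1)^{\Omega(n)}$ is the Liouville function and $\Omega(n)$ is the number of prime factors of $n$ counted with multiplicity. A positive integer $n$ is called super-imperfect if $2\beta(\beta(n))=n$. -}

module Defs where

open import Data.Nat using (ℕ; zero; suc; _+_; _*_; _∸_; _^_; _≤ᵇ_)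
open import Data.Nat.DivMod using (_/_; _%_)
open import Data.Nat.Divisibility using (_∣?_)
open import Data.List using (List; []; _∷_; filter; map; sum; upTo)
open import Data.Integer as ℤ using (ℤ; +_; -_)
open import Relation.Nullary.Decidable using (does)
open import Data.Bool using (if_then_else_)
open import Relation.Binary.PropositionalEquality using (_≡_)

-- Smallest divisor d of n with 2 ≤ d ≤ n, searched from `start` upward with fuel.
-- (For n ≥ 2 this is the least prime factor of n.)
leastFactorFrom : (fuel start n : ℕ) → ℕ
leastFactorFrom zero start n = n
leastFactorFrom (suc fuel) start n =
  if does (start ∣? n) then start else leastFactorFrom fuel (suc start) n

leastPrimeFactor : ℕ → ℕ
leastPrimeFactor n = leastFactorFrom n 2 n

-- Ω n : number of prime factors of n counted with multiplicity (Ω 0 = Ω 1 = 0).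
-- Repeatedly divide out the least prime factor; fuel n suffices since each step halves at least.
Ω-fuel : ℕ → ℕ → ℕ
Ω-fuel zero n = 0
Ω-fuel (suc fuel) n with n ≤ᵇ 1
... | Data.Bool.true = 0
... | Data.Bool.false with leastPrimeFactor n
...   | zero = 0
...   | p@(suc _) = suc (Ω-fuel fuel (n / p))

Ω : ℕ → ℕ
Ω n = Ω-fuel n n

liouville : ℕ → ℤ
liouville n = (ℤ.- ℤ.+ 1) ℤ.^ Ω n

-- positive divisors of n, listed as predecessors (d = suc e), increasing
divisorsPred : ℕ → List ℕ
divisorsPred n = filter (λ e → suc e ∣? n) (upTo n)

-- β(n) = Σ_{d ∣ n} d · λ(n/d)   (for n ≥ 1)
β : ℕ → ℤ
β zero = + 0
β n@(suc _) = Data.List.foldr ℤ._+_ (+ 0) (map (λ e → (+ suc e) ℤ.* liouville (n / suc e)) (divisorsPred n))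

-- super-imperfect: 2 β(β(n)) = n.  β(n) ≥ 1 for n ≥ 1, so we apply β to ∣β n∣.
SuperImperfect : ℕ → Set
SuperImperfect n = + 2 ℤ.* β ℤ.∣ β n ∣ ≡ + n

module Submission where

-- Everything rests on a recursion for β along a prime p.  Splitting the
-- divisors of p·s into multiples of p and the rest gives, for s ≥ 1,
--   β(p·s) = p·β(s) − γₚ(s),   where γₚ(s) = Σ_{d ∣ s, p ∤ d} d·λ(s/d),
-- and since λ(p·x) = −λ(x), also γₚ(p·s) = −γₚ(s), while γₚ(s) = β(s) if p ∤ s.
-- Two consequences drive the theorem:
--   (i)  β(p·s) = (p − 1)·β(s) for a prime p ∤ s;
--   (ii) β(p^(a+1)) = p·β(p^a) − (−1)^a, whence 3·β(2^a) = 2^(a+1) + (−1)^a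
--        and 3·β(n_k) + 1 = 2^(2^k).
-- For k ≤ 5, β(n_k) is a product of distinct Fermat primes 2^(2^i) + 1 and (i)
-- gives 2·β(β(n_k)) = n_k directly.  For k ≥ 6, β(n_k) = 641·R with 641 ∤ R
-- (641 divides 2^32 + 1), so (i) makes 640 divide β(β(n_k)); then 5 divides
-- 2·β(β(n_k)), which therefore is not the power of two n_k.

open import Defs
open import Data.Nat using (ℕ; _≤_; _^_; _∸_)
open import Function.Bundles using (_⇔_; mk⇔)

open import Data.Nat as ℕ using (zero; suc; pred; _<_; z≤n; s≤s; NonZero; _≤?_)
import Data.Nat.Properties as ℕₚ
open import Data.Nat.Divisibility
  using ( _∣_; _∤_; _∣?_; divides; ∣-refl; hasNonTrivialDivisor; _∣0; ∣-trans; ∣⇒≤; ∣m+n∣m⇒∣n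
        ; m∣m*n; ∣m⇒∣m*n; ∣n⇒∣m*n; *-monoʳ-∣; *-cancelˡ-∣)
open import Data.Nat.DivMod using (_/_; m*n/n≡m; m/n<m; m≥n⇒m/n>0; m*n/m*o≡n/o; *-/-assoc)
open import Data.Nat.Primality
  using (Prime; prime[2]; _Rough_; rough∧∣⇒prime; euclidsLemma; prime⇒irreducible; prime?)
open import Data.Nat.Coprimality using (Coprime; coprime-divisor)
open import Data.Nat.Induction using (<-rec)
open import Data.Integer as ℤ using (ℤ; +_; -_)
import Data.Integer.Properties as ℤₚ
open import Data.Integer.Tactic.RingSolver using (solve-∀)
import Data.Nat.Tactic.RingSolver as NatSolver
open import Data.Bool using (true; false; if_then_else_)
open import Data.List using (List; []; _∷_; filter; map; foldr; applyUpTo)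
open import Data.Nat.ListAction using (product)
open import Data.Product using (_×_; _,_; proj₁; proj₂)
open import Data.Sum using (inj₁; inj₂)
open import Function using (_∘_)
open import Relation.Unary using (Pred; Decidable)
open import Relation.Nullary using (¬_; Dec; yes; no; contradiction)
open import Relation.Nullary.Decidable using (does; dec-true; dec-false; from-yes; from-no)
open import Relation.Binary.PropositionalEquality using (_≡_; refl; sym; trans; cong; cong₂; subst; module ≡-Reasoning)

-- Counting prime factors: Ω(p·x) = Ω(x) + 1.

module PrimeFactorCount where
  open import Data.Nat using (_+_; _*_; _≤ᵇ_)
  open ℕₚ using ( ≤-refl; ≤-trans; ≤-pred; <⇒≱; ≤∧≢⇒<; m<1+n⇒m<n∨m≡n; +-identityʳ; +-suc; *-comm; *-assoc
                ; m<m*n; m≤m*n; n≢0⇒n>0; m<n+m)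

  IsLeastFactor : ℕ → ℕ → Set
  IsLeastFactor n q = 2 ≤ q × q ∣ n × (∀ {d} → 2 ≤ d → d < q → d ∤ n)

  leastFactorFrom-correct : ∀ fuel start n → 2 ≤ start → start ≤ n → n < start + fuel →
    (∀ {d} → 2 ≤ d → d < start → d ∤ n) → IsLeastFactor n (leastFactorFrom fuel start n)
  leastFactorFrom-correct zero start n _ s≤n n<s+0 _ =
    contradiction s≤n (<⇒≱ (subst (n <_) (+-identityʳ start) n<s+0))
  leastFactorFrom-correct (suc fuel) start n 2≤s s≤n n<s+f below with start ∣? n
  ... | yes s∣n = 2≤s , s∣n , below
  ... | no s∤n = leastFactorFrom-correct fuel (suc start) n (≤-trans 2≤s (ℕₚ.n≤1+n start))
                   (≤∧≢⇒< s≤n (λ { refl → s∤n ∣-refl }))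
                   (subst (n <_) (+-suc start fuel) n<s+f) below′
    where
    below′ : ∀ {d} → 2 ≤ d → d < suc start → d ∤ n
    below′ 2≤d d<1+s with m<1+n⇒m<n∨m≡n d<1+s
    ... | inj₁ d<s = below 2≤d d<s
    ... | inj₂ refl = s∤n

  leastPrimeFactor-correct : ∀ {n} → 2 ≤ n → IsLeastFactor n (leastPrimeFactor n)
  leastPrimeFactor-correct {n} 2≤n =
    leastFactorFrom-correct n 2 n ≤-refl 2≤n (m<n+m n (s≤s z≤n)) (λ 2≤d d<2 → contradiction 2≤d (<⇒≱ d<2))

  leastFactor-prime : ∀ {n q} → IsLeastFactor n q → Prime q
  leastFactor-prime {n} {q} (2≤q , q∣n , below) =
    rough∧∣⇒prime {{ℕ.n>1⇒nonTrivial 2≤q}} rough q∣n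
    where
    rough : q Rough n
    rough (hasNonTrivialDivisor {d} d<q d∣n) = below (ℕ.nonTrivial⇒n>1 d) d<q d∣n

  not≤ᵇ1 : ∀ m → (m ≤ᵇ 1) ≡ false → 2 ≤ m
  not≤ᵇ1 zero          ()
  not≤ᵇ1 (suc zero)    ()
  not≤ᵇ1 (suc (suc _)) _ = s≤s (s≤s z≤n)

  Ω-fuel-irrelevant : ∀ f g m → m ≤ f → m ≤ g → Ω-fuel f m ≡ Ω-fuel g m
  Ω-fuel-irrelevant zero    zero    m       _   _   = refl
  Ω-fuel-irrelevant zero    (suc g) .zero   z≤n _   = refl
  Ω-fuel-irrelevant (suc f) zero    .zero   _   z≤n = refl
  Ω-fuel-irrelevant (suc f) (suc g) m       m≤f m≤g with m ≤ᵇ 1 in m>1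
  ... | true = refl
  ... | false with leastPrimeFactor m in lpf≡
  ...   | zero = refl
  ...   | suc q =
    cong suc (Ω-fuel-irrelevant f g (m / suc q) (≤-pred (≤-trans m/q<m m≤f)) (≤-pred (≤-trans m/q<m m≤g)))
    where
    2≤m : 2 ≤ m
    2≤m = not≤ᵇ1 m m>1
    2≤q : 2 ≤ suc q
    2≤q = subst (2 ≤_) lpf≡ (proj₁ (leastPrimeFactor-correct 2≤m))
    m/q<m : m / suc q < m
    m/q<m = m/n<m m (suc q) {{ℕ.>-nonZero (≤-trans (s≤s z≤n) 2≤m)}} 2≤q

  Ω-unfold : ∀ {n q} → 2 ≤ n → leastPrimeFactor n ≡ suc q → Ω n ≡ suc (Ω (n / suc q))
  Ω-unfold {suc zero} (s≤s ()) _
  Ω-unfold {suc (suc k)} _ lpf≡ with leastPrimeFactor (suc (suc k)) in lpf≡′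
  Ω-unfold {suc (suc k)} _ refl | suc q =
    cong suc (Ω-fuel-irrelevant (suc k) (n / suc q) (n / suc q) (≤-pred m/q<m) ≤-refl)
    where
    n = suc (suc k)
    2≤q : 2 ≤ suc q
    2≤q = subst (2 ≤_) lpf≡′ (proj₁ (leastPrimeFactor-correct {n} (s≤s (s≤s z≤n))))
    m/q<m : n / suc q < n
    m/q<m = m/n<m n (suc q) 2≤q

  prime≥2 : ∀ {p} → Prime p → 2 ≤ p
  prime≥2 {suc (suc _)} _ = s≤s (s≤s z≤n)

  -- Strong induction on x:
  -- if the least prime factor q of p·x is p, divide it out; otherwise q ∣ x,
  -- say x = y·q, and the hypothesis for y, applied to p and to q, closes the gap.
  Ω-prime-mul : ∀ {p} → Prime p → ∀ {x} → 1 ≤ x → Ω (p * x) ≡ suc (Ω x)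
  Ω-prime-mul pp {x} 1≤x = <-rec P step x 1≤x pp
    where
    P : ℕ → Set
    P x = 1 ≤ x → ∀ {p} → Prime p → Ω (p * x) ≡ suc (Ω x)

    step : ∀ x → (∀ {y} → y < x → P y) → P x
    step x rec 1≤x {p} pp = divideOut (leastPrimeFactor (p * x)) refl
      where
      open ≡-Reasoning
      2≤px : 2 ≤ p * x
      2≤px = ≤-trans (prime≥2 pp) (m≤m*n p x {{ℕ.>-nonZero 1≤x}})

      least : IsLeastFactor (p * x) (leastPrimeFactor (p * x))
      least = leastPrimeFactor-correct 2≤px

      leastIs : ∀ {l} → leastPrimeFactor (p * x) ≡ l → IsLeastFactor (p * x) l
      leastIs lpf≡ = subst (IsLeastFactor (p * x)) lpf≡ least

      factorPrime : ∀ {l} → leastPrimeFactor (p * x) ≡ l → Prime l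
      factorPrime lpf≡ = leastFactor-prime (leastIs lpf≡)

      divideOut : ∀ l → leastPrimeFactor (p * x) ≡ l → Ω (p * x) ≡ suc (Ω x)
      divideOut zero lpf≡ = contradiction (factorPrime lpf≡) λ ()
      divideOut (suc q) lpf≡
        with suc q ℕ.≟ p | euclidsLemma p x (factorPrime lpf≡) (proj₁ (proj₂ (leastIs lpf≡)))
      ... | yes refl | _ =
        trans (Ω-unfold 2≤px lpf≡) (cong (suc ∘ Ω) (trans (cong (_/ p) (*-comm p x)) (m*n/n≡m x p)))
      ... | no q≢p | inj₁ q∣p with prime⇒irreducible pp q∣p
      ...   | inj₁ q≡1 = contradiction (subst (2 ≤_) q≡1 (prime≥2 (factorPrime lpf≡))) λ { (s≤s ()) }
      ...   | inj₂ q≡p = contradiction q≡p q≢p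
      divideOut (suc q) lpf≡ | no _ | inj₂ (divides y x≡y*q) = begin
        Ω (p * x)                  ≡⟨ Ω-unfold 2≤px lpf≡ ⟩
        suc (Ω (p * x / suc q))    ≡⟨ cong (suc ∘ Ω) px/q≡py ⟩
        suc (Ω (p * y))            ≡⟨ cong suc (rec y<x 1≤y pp) ⟩
        suc (suc (Ω y))            ≡⟨ cong suc (rec y<x 1≤y qPrime) ⟨
        suc (Ω (suc q * y))        ≡⟨ cong (suc ∘ Ω) (trans x≡y*q (*-comm y (suc q))) ⟨
        suc (Ω x)                  ∎
        where
        qPrime : Prime (suc q)
        qPrime = factorPrime lpf≡
        1≤y : 1 ≤ y
        1≤y = n≢0⇒n>0 λ { refl → contradiction (subst (1 ≤_) x≡y*q 1≤x) λ () }
        y<x : y < x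
        y<x = subst (y <_) (sym x≡y*q) (m<m*n y (suc q) {{ℕ.>-nonZero 1≤y}} (prime≥2 qPrime))
        px/q≡py : p * x / suc q ≡ p * y
        px/q≡py = begin
          p * x / suc q          ≡⟨ cong (λ z → p * z / suc q) x≡y*q ⟩
          p * (y * suc q) / suc q ≡⟨ cong (_/ suc q) (*-assoc p y (suc q)) ⟨
          p * y * suc q / suc q   ≡⟨ m*n/n≡m (p * y) (suc q) ⟩
          p * y                  ∎

-- The Fermat quotient used for k ≥ 6.

module FermatQuotient where
  open import Data.Nat using (_+_; _*_)

  prime641 : Prime 641
  prime641 = from-yes (prime? 641)

  -- Rⱼ = (2^(2^(j+6)) − 1) / 1923, where 1923 = 3·641.  With x = 2^(2^(j+6))
  -- the recursion is x² − 1 = (x − 1)·(x + 1), i.e. R_{j+1} = Rⱼ·(1923·Rⱼ + 2).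
  R : ℕ → ℕ
  R zero    = 9592690625954005
  R (suc j) = R j * (1923 * R j + 2)

  R-spec : ∀ j → 1923 * R j + 1 ≡ 2 ^ 2 ^ (6 + j)
  R-spec zero    = refl
  R-spec (suc j) = begin
    1923 * (R j * (1923 * R j + 2)) + 1 ≡⟨ square (R j) ⟩
    (1923 * R j + 1) * (1923 * R j + 1) ≡⟨ cong₂ _*_ (R-spec j) (R-spec j) ⟩
    2 ^ x * 2 ^ x                       ≡⟨ ℕₚ.^-distribˡ-+-* 2 x x ⟨
    2 ^ (x + x)                         ≡⟨ cong (λ y → 2 ^ (x + y)) (ℕₚ.+-identityʳ x) ⟨
    2 ^ 2 ^ (6 + suc j)                 ∎
    where
    open ≡-Reasoning
    x = 2 ^ (6 + j)
    square : ∀ r → 1923 * (r * (1923 * r + 2)) + 1 ≡ (1923 * r + 1) * (1923 * r + 1)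
    square = NatSolver.solve-∀

  -- 641 ∤ Rⱼ: 641 ∤ R₀ by computation, and 641 ∤ 1923·Rⱼ + 2 because 641 ∤ 2.
  641∤R : ∀ j → 641 ∤ R j
  641∤R zero = from-no (641 ∣? R 0)
  641∤R (suc j) 641∣ with euclidsLemma (R j) (1923 * R j + 2) prime641 641∣
  ... | inj₁ 641∣R = 641∤R j 641∣R
  ... | inj₂ 641∣1923R+2 = from-no (641 ∣? 2) (∣m+n∣m⇒∣n 641∣1923R+2 (∣m⇒∣m*n (R j) (divides 3 refl)))

open PrimeFactorCount using (Ω-prime-mul; prime≥2)

-- From here on the arithmetic operators are those of ℤ; operations on ℕ are
-- written qualified.
open import Data.Integer using (_+_; _-_; _*_)

sign : ℕ → ℤ
sign a = (- + 1) ℤ.^ a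

sign-suc : ∀ a → sign (suc a) ≡ - sign a
sign-suc a = ℤₚ.-1*i≡-i (sign a)

sign-even : ∀ t → sign (t ℕ.+ t) ≡ + 1
sign-even zero    = refl
sign-even (suc t) = begin
  sign (suc t ℕ.+ suc t)   ≡⟨ cong (sign ∘ suc) (ℕₚ.+-suc t t) ⟩
  sign (suc (suc (t ℕ.+ t))) ≡⟨ trans (sign-suc (suc (t ℕ.+ t))) (cong -_ (sign-suc (t ℕ.+ t))) ⟩
  - - sign (t ℕ.+ t)       ≡⟨ ℤₚ.neg-involutive (sign (t ℕ.+ t)) ⟩
  sign (t ℕ.+ t)           ≡⟨ sign-even t ⟩
  + 1                      ∎
  where open ≡-Reasoning

sign-mersenne : ∀ k → 1 ≤ k → sign (2 ^ k ∸ 1) ≡ - + 1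
sign-mersenne (suc k) _ = oddSign (2 ^ k) (ℕₚ.m^n>0 2 k)
  where
  oddSign : ∀ m → 1 ≤ m → sign (2 ℕ.* m ∸ 1) ≡ - + 1
  oddSign (suc t) _ = begin
    sign (t ℕ.+ suc (t ℕ.+ 0)) ≡⟨ cong (λ u → sign (t ℕ.+ suc u)) (ℕₚ.+-identityʳ t) ⟩
    sign (t ℕ.+ suc t)         ≡⟨ cong sign (ℕₚ.+-suc t t) ⟩
    sign (suc (t ℕ.+ t))       ≡⟨ trans (sign-suc (t ℕ.+ t)) (cong -_ (sign-even t)) ⟩
    - + 1                      ∎
    where open ≡-Reasoning

liouville-prime-mul : ∀ {p x} → Prime p → 1 ≤ x → liouville (p ℕ.* x) ≡ - liouville x
liouville-prime-mul {x = x} pp 1≤x = trans (cong sign (Ω-prime-mul pp 1≤x)) (sign-suc (Ω x))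

-- Finite sums ∑ G n = G 1 + G 2 + ⋯ + G n over ℤ.

∑ : (ℕ → ℤ) → ℕ → ℤ
∑ G zero    = + 0
∑ G (suc n) = ∑ G n + G (suc n)

∑-cong : ∀ {G H} → (∀ e → G (suc e) ≡ H (suc e)) → ∀ n → ∑ G n ≡ ∑ H n
∑-cong G≡H zero    = refl
∑-cong G≡H (suc n) = cong₂ _+_ (∑-cong G≡H n) (G≡H n)

∑-first : ∀ G n → ∑ G (suc n) ≡ G 1 + ∑ (G ∘ suc) n
∑-first G zero    = trans (ℤₚ.+-identityˡ (G 1)) (sym (ℤₚ.+-identityʳ (G 1)))
∑-first G (suc n) = trans (cong (_+ G (suc (suc n))) (∑-first G n)) (ℤₚ.+-assoc (G 1) _ _)

∑-+ : ∀ G H n → ∑ (λ d → G d + H d) n ≡ ∑ G n + ∑ H n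
∑-+ G H zero    = refl
∑-+ G H (suc n) =
  trans (cong (_+ (G (suc n) + H (suc n))) (∑-+ G H n)) (interchange (∑ G n) (∑ H n) (G (suc n)) (H (suc n)))
  where
  interchange : ∀ a b c d → (a + b) + (c + d) ≡ (a + c) + (b + d)
  interchange = solve-∀

∑-scale : ∀ c G n → ∑ (λ d → c * G d) n ≡ c * ∑ G n
∑-scale c G zero    = sym (ℤₚ.*-zeroʳ c)
∑-scale c G (suc n) = trans (cong (_+ c * G (suc n)) (∑-scale c G n)) (sym (ℤₚ.*-distribˡ-+ c (∑ G n) _))

∑-neg : ∀ G n → ∑ (λ d → - G d) n ≡ - ∑ G n
∑-neg G zero    = refl
∑-neg G (suc n) = trans (cong (_+ - G (suc n)) (∑-neg G n)) (sym (ℤₚ.neg-distrib-+ (∑ G n) _))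

∑-++ : ∀ G a b → ∑ G (a ℕ.+ b) ≡ ∑ G a + ∑ (λ d → G (a ℕ.+ d)) b
∑-++ G a zero    = trans (cong (∑ G) (ℕₚ.+-identityʳ a)) (sym (ℤₚ.+-identityʳ (∑ G a)))
∑-++ G a (suc b) = begin
  ∑ G (a ℕ.+ suc b)
    ≡⟨ cong (∑ G) (ℕₚ.+-suc a b) ⟩
  ∑ G (a ℕ.+ b) + G (suc (a ℕ.+ b))
    ≡⟨ cong₂ _+_ (∑-++ G a b) (cong G (sym (ℕₚ.+-suc a b))) ⟩
  (∑ G a + ∑ (λ d → G (a ℕ.+ d)) b) + G (a ℕ.+ suc b)
    ≡⟨ ℤₚ.+-assoc (∑ G a) _ _ ⟩
  ∑ G a + ∑ (λ d → G (a ℕ.+ d)) (suc b) ∎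
  where open ≡-Reasoning

∑-vanishing : ∀ G n → (∀ e → e < n → G (suc e) ≡ + 0) → ∑ G n ≡ + 0
∑-vanishing G zero    _     = refl
∑-vanishing G (suc n) G≡0 =
  cong₂ _+_ (∑-vanishing G n (λ e e<n → G≡0 e (ℕₚ.m<n⇒m<1+n e<n))) (G≡0 n ℕₚ.≤-refl)

∑-beyond : ∀ G s m → (∀ d → s < d → G d ≡ + 0) → ∑ G (s ℕ.+ m) ≡ ∑ G s
∑-beyond G s m G≡0 = begin
  ∑ G (s ℕ.+ m)
    ≡⟨ ∑-++ G s m ⟩
  ∑ G s + ∑ (λ d → G (s ℕ.+ d)) m
    ≡⟨ cong (λ t → ∑ G s + t) (∑-vanishing _ m (λ e _ → G≡0 _ (ℕₚ.m<m+n s (s≤s z≤n)))) ⟩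
  ∑ G s + + 0
    ≡⟨ ℤₚ.+-identityʳ (∑ G s) ⟩
  ∑ G s ∎
  where open ≡-Reasoning

onMultiplesOf : ℕ → (ℕ → ℤ) → ℕ → ℤ
onMultiplesOf p G d = if does (p ∣? d) then G d else + 0

offMultiplesOf : ℕ → (ℕ → ℤ) → ℕ → ℤ
offMultiplesOf p G d = if does (p ∣? d) then + 0 else G d

module _ {p : ℕ} {G : ℕ → ℤ} {d : ℕ} where

  on-multiple : p ∣ d → onMultiplesOf p G d ≡ G d
  on-multiple p∣d rewrite dec-true (p ∣? d) p∣d = refl

  on-nonmultiple : p ∤ d → onMultiplesOf p G d ≡ + 0
  on-nonmultiple p∤d rewrite dec-false (p ∣? d) p∤d = refl

  off-multiple : p ∣ d → offMultiplesOf p G d ≡ + 0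
  off-multiple p∣d rewrite dec-true (p ∣? d) p∣d = refl

  off-nonmultiple : p ∤ d → offMultiplesOf p G d ≡ G d
  off-nonmultiple p∤d rewrite dec-false (p ∣? d) p∤d = refl

  split-multiples : G d ≡ onMultiplesOf p G d + offMultiplesOf p G d
  split-multiples with does (p ∣? d)
  ... | true  = sym (ℤₚ.+-identityʳ (G d))
  ... | false = sym (ℤₚ.+-identityˡ (G d))

-- Strictly between the consecutive multiples p·N and p·(N+1) there is no
-- multiple of p, so that block of the restricted sum is the single term at p·(N+1).
∑-between-multiples : ∀ p .{{_ : NonZero p}} G N →
  ∑ (λ i → onMultiplesOf p G (p ℕ.* N ℕ.+ i)) p ≡ G (p ℕ.* suc N)
∑-between-multiples p@(suc p′) G N = begin
  ∑ (λ i → onMultiplesOf p G (p ℕ.* N ℕ.+ i)) p′ + onMultiplesOf p G (p ℕ.* N ℕ.+ p)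
    ≡⟨ cong₂ _+_ (∑-vanishing _ p′ λ e e<p′ → on-nonmultiple {p} {G} (noMultiple e e<p′))
                 (cong (onMultiplesOf p G) next) ⟩
  + 0 + onMultiplesOf p G (p ℕ.* suc N)
    ≡⟨ trans (ℤₚ.+-identityˡ _) (on-multiple {p} {G} (m∣m*n (suc N))) ⟩
  G (p ℕ.* suc N) ∎
  where
  open ≡-Reasoning
  next : p ℕ.* N ℕ.+ p ≡ p ℕ.* suc N
  next = trans (ℕₚ.+-comm (p ℕ.* N) p) (sym (ℕₚ.*-suc p N))
  noMultiple : ∀ e → e < p′ → p ∤ p ℕ.* N ℕ.+ suc e
  noMultiple e e<p′ p∣ = ℕₚ.<⇒≱ (s≤s e<p′) (∣⇒≤ (∣m+n∣m⇒∣n p∣ (m∣m*n N)))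

∑-multiples : ∀ p .{{_ : NonZero p}} G N → ∑ (onMultiplesOf p G) (p ℕ.* N) ≡ ∑ (λ d → G (p ℕ.* d)) N
∑-multiples p G zero    = cong (∑ (onMultiplesOf p G)) (ℕₚ.*-zeroʳ p)
∑-multiples p G (suc N) = begin
  ∑ (onMultiplesOf p G) (p ℕ.* suc N)
    ≡⟨ cong (∑ (onMultiplesOf p G)) (trans (ℕₚ.*-suc p N) (ℕₚ.+-comm p (p ℕ.* N))) ⟩
  ∑ (onMultiplesOf p G) (p ℕ.* N ℕ.+ p)
    ≡⟨ ∑-++ (onMultiplesOf p G) (p ℕ.* N) p ⟩
  ∑ (onMultiplesOf p G) (p ℕ.* N) + ∑ (λ i → onMultiplesOf p G (p ℕ.* N ℕ.+ i)) p
    ≡⟨ cong₂ _+_ (∑-multiples p G N) (∑-between-multiples p G N) ⟩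
  ∑ (λ d → G (p ℕ.* d)) (suc N) ∎
  where open ≡-Reasoning

-- β as a divisor sum over 1..n.

summand : ℕ → ℕ → ℤ
summand n zero    = + 0
summand n (suc e) = if does (suc e ∣? n) then + suc e * liouville (n / suc e) else + 0

summand-divisor : ∀ n d .{{_ : NonZero d}} → d ∣ n → summand n d ≡ + d * liouville (n / d)
summand-divisor n (suc e) d∣n rewrite dec-true (suc e ∣? n) d∣n = refl

summand-nondivisor : ∀ n d → d ∤ n → summand n d ≡ + 0
summand-nondivisor n zero    _   = refl
summand-nondivisor n (suc e) d∤n rewrite dec-false (suc e ∣? n) d∤n = refl

summand-beyond : ∀ n d → 1 ≤ n → n < d → summand n d ≡ + 0
summand-beyond n d 1≤n n<d =
  summand-nondivisor n d (λ d∣n → ℕₚ.<⇒≱ n<d (∣⇒≤ {{ℕ.>-nonZero 1≤n}} d∣n))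

∑-filter : ∀ {ℓ} {P : Pred ℕ ℓ} (P? : Decidable P) (g : ℕ → ℤ) (h : ℕ → ℕ) (m : ℕ) →
  foldr _+_ (+ 0) (map g (filter P? (applyUpTo h m)))
    ≡ ∑ (λ i → if does (P? (h (pred i))) then g (h (pred i)) else + 0) m
∑-filter P? g h zero = refl
∑-filter P? g h (suc m) rewrite ∑-first (λ i → if does (P? (h (pred i))) then g (h (pred i)) else + 0) m
  with does (P? (h 0))
... | true  = cong (_+_ (g (h 0))) (trans (∑-filter P? g (h ∘ suc) m) (∑-cong (λ _ → refl) m))
... | false = trans (trans (∑-filter P? g (h ∘ suc) m) (∑-cong (λ _ → refl) m)) (sym (ℤₚ.+-identityˡ _))

β-as-sum : ∀ s → 1 ≤ s → β s ≡ ∑ (summand s) s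
β-as-sum s@(suc _) _ =
  trans (∑-filter (λ e → suc e ∣? s) (λ e → + suc e * liouville (s / suc e)) (λ e → e) s)
        (∑-cong (λ _ → refl) s)

-- The recursion of β along a prime p.

-- γₚ(s) = Σ_{d ∣ s, p ∤ d} d·λ(s/d): the part of β(s) from divisors prime to p.
coprimePart : ℕ → ℕ → ℤ
coprimePart p s = ∑ (offMultiplesOf p (summand s)) s

summand-scale : ∀ p s d .{{_ : NonZero p}} .{{_ : NonZero d}} →
  summand (p ℕ.* s) (p ℕ.* d) ≡ + p * summand s d
summand-scale p s d = byDivisibility (d ∣? s)
  where
  open ≡-Reasoning
  instance
    pd≢0 : NonZero (p ℕ.* d)
    pd≢0 = ℕₚ.m*n≢0 p d

  byDivisibility : Dec (d ∣ s) → summand (p ℕ.* s) (p ℕ.* d) ≡ + p * summand s d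
  byDivisibility (yes d∣s) = begin
    summand (p ℕ.* s) (p ℕ.* d)
      ≡⟨ summand-divisor (p ℕ.* s) (p ℕ.* d) (*-monoʳ-∣ p d∣s) ⟩
    + (p ℕ.* d) * liouville (p ℕ.* s / (p ℕ.* d))
      ≡⟨ cong₂ _*_ (ℤₚ.pos-* p d) (cong liouville (m*n/m*o≡n/o p s d)) ⟩
    + p * + d * liouville (s / d)
      ≡⟨ ℤₚ.*-assoc (+ p) (+ d) _ ⟩
    + p * (+ d * liouville (s / d))
      ≡⟨ cong (_*_ (+ p)) (summand-divisor s d d∣s) ⟨
    + p * summand s d ∎
  byDivisibility (no d∤s) = begin
    summand (p ℕ.* s) (p ℕ.* d) ≡⟨ summand-nondivisor (p ℕ.* s) (p ℕ.* d) (d∤s ∘ *-cancelˡ-∣ p) ⟩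
    + 0                         ≡⟨ ℤₚ.*-zeroʳ (+ p) ⟨
    + p * + 0                   ≡⟨ cong (_*_ (+ p)) (summand-nondivisor s d d∤s) ⟨
    + p * summand s d           ∎

coprime-divisor-prime : ∀ {p d s} → Prime p → p ∤ d → d ∣ p ℕ.* s → d ∣ s
coprime-divisor-prime {p} pp p∤d = coprime-divisor coprime
  where
  coprime : Coprime _ p
  coprime (c∣d , c∣p) with prime⇒irreducible pp c∣p
  ... | inj₁ c≡1 = c≡1
  ... | inj₂ refl = contradiction c∣d p∤d

-- A divisor d of p·s prime to p contributes −1 times what it contributes to s,
-- because λ(p·(s/d)) = −λ(s/d).
summand-prime-mul : ∀ {p s} d → Prime p → 1 ≤ s → p ∤ d → summand (p ℕ.* s) d ≡ - summand s d
summand-prime-mul zero _ _ _ = refl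
summand-prime-mul {p} {s} d@(suc _) pp 1≤s p∤d with d ∣? s
... | yes d∣s = begin
  summand (p ℕ.* s) d
    ≡⟨ summand-divisor (p ℕ.* s) d (∣n⇒∣m*n p d∣s) ⟩
  + d * liouville (p ℕ.* s / d)
    ≡⟨ cong (λ z → + d * liouville z) (*-/-assoc p d∣s) ⟩
  + d * liouville (p ℕ.* (s / d))
    ≡⟨ cong (_*_ (+ d)) (liouville-prime-mul pp (m≥n⇒m/n>0 (∣⇒≤ {{ℕ.>-nonZero 1≤s}} d∣s))) ⟩
  + d * - liouville (s / d)
    ≡⟨ ℤₚ.neg-distribʳ-* (+ d) _ ⟨
  - (+ d * liouville (s / d))
    ≡⟨ cong -_ (summand-divisor s d d∣s) ⟨
  - summand s d ∎
  where open ≡-Reasoning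
... | no d∤s = trans (summand-nondivisor (p ℕ.* s) d (d∤s ∘ coprime-divisor-prime pp p∤d))
                     (cong -_ (sym (summand-nondivisor s d d∤s)))

-- γₚ(p·s) = −γₚ(s): the divisors of p·s prime to p are those of s, each
-- contributing with the opposite sign, and terms beyond s vanish.
coprimePart-prime-mul : ∀ {p s} → Prime p → 1 ≤ s → coprimePart p (p ℕ.* s) ≡ - coprimePart p s
coprimePart-prime-mul {p@(suc p′)} {s} pp 1≤s = begin
  ∑ (offMultiplesOf p (summand (p ℕ.* s))) (p ℕ.* s)
    ≡⟨ ∑-cong (λ e → negated (suc e)) (p ℕ.* s) ⟩
  ∑ (λ d → - offMultiplesOf p (summand s) d) (p ℕ.* s)
    ≡⟨ ∑-neg (offMultiplesOf p (summand s)) (p ℕ.* s) ⟩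
  - ∑ (offMultiplesOf p (summand s)) (s ℕ.+ p′ ℕ.* s)
    ≡⟨ cong -_ (∑-beyond (offMultiplesOf p (summand s)) s (p′ ℕ.* s) beyond) ⟩
  - coprimePart p s ∎
  where
  open ≡-Reasoning
  negated : ∀ d → offMultiplesOf p (summand (p ℕ.* s)) d ≡ - offMultiplesOf p (summand s) d
  negated d with p ∣? d
  ... | yes p∣d = trans (off-multiple {p} {summand (p ℕ.* s)} p∣d) (sym (cong -_ (off-multiple {p} {summand s} p∣d)))
  ... | no p∤d  = begin
    offMultiplesOf p (summand (p ℕ.* s)) d ≡⟨ off-nonmultiple {p} {summand (p ℕ.* s)} p∤d ⟩
    summand (p ℕ.* s) d                    ≡⟨ summand-prime-mul d pp 1≤s p∤d ⟩
    - summand s d                          ≡⟨ cong -_ (off-nonmultiple {p} {summand s} p∤d) ⟨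
    - offMultiplesOf p (summand s) d       ∎
  beyond : ∀ d → s < d → offMultiplesOf p (summand s) d ≡ + 0
  beyond d s<d with p ∣? d
  ... | yes p∣d = off-multiple {p} {summand s} p∣d
  ... | no p∤d  = trans (off-nonmultiple {p} {summand s} p∤d) (summand-beyond s d 1≤s s<d)

-- β(p·s) = p·β(s) − γₚ(s): the multiples of p among the divisors of p·s give
-- p·β(s), the others give −γₚ(s).
β-prime-mul : ∀ {p s} → Prime p → 1 ≤ s → β (p ℕ.* s) ≡ + p * β s - coprimePart p s
β-prime-mul {p@(suc _)} {s} pp 1≤s = begin
  β (p ℕ.* s)
    ≡⟨ β-as-sum (p ℕ.* s) (ℕₚ.≤-trans 1≤s (ℕₚ.m≤n*m s p)) ⟩
  ∑ (summand (p ℕ.* s)) (p ℕ.* s)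
    ≡⟨ ∑-cong (λ e → split-multiples {p} {summand (p ℕ.* s)} {suc e}) (p ℕ.* s) ⟩
  ∑ (λ d → onMultiplesOf p (summand (p ℕ.* s)) d + offMultiplesOf p (summand (p ℕ.* s)) d) (p ℕ.* s)
    ≡⟨ ∑-+ _ _ (p ℕ.* s) ⟩
  ∑ (onMultiplesOf p (summand (p ℕ.* s))) (p ℕ.* s) + coprimePart p (p ℕ.* s)
    ≡⟨ cong₂ _+_ (∑-multiples p (summand (p ℕ.* s)) s) (coprimePart-prime-mul pp 1≤s) ⟩
  ∑ (λ d → summand (p ℕ.* s) (p ℕ.* d)) s - coprimePart p s
    ≡⟨ cong (_- coprimePart p s) (∑-cong (λ e → summand-scale p s (suc e)) s) ⟩
  ∑ (λ d → + p * summand s d) s - coprimePart p s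
    ≡⟨ cong (_- coprimePart p s) (trans (∑-scale (+ p) (summand s) s) (cong (_*_ (+ p)) (sym (β-as-sum s 1≤s)))) ⟩
  + p * β s - coprimePart p s ∎
  where open ≡-Reasoning

-- γₚ(s) = β(s) when p ∤ s, since then no divisor of s is a multiple of p.
coprimePart-coprime : ∀ {p s} → p ∤ s → 1 ≤ s → coprimePart p s ≡ β s
coprimePart-coprime {p} {s} p∤s 1≤s = trans (∑-cong unrestricted s) (sym (β-as-sum s 1≤s))
  where
  unrestricted : ∀ e → offMultiplesOf p (summand s) (suc e) ≡ summand s (suc e)
  unrestricted e = byDivisibility (p ∣? suc e)
    where
    byDivisibility : Dec (p ∣ suc e) → offMultiplesOf p (summand s) (suc e) ≡ summand s (suc e)
    byDivisibility (yes p∣d) =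
      trans (off-multiple {p} {summand s} p∣d) (sym (summand-nondivisor s (suc e) (p∤s ∘ ∣-trans p∣d)))
    byDivisibility (no p∤d) = off-nonmultiple {p} {summand s} p∤d

β-prime-coprime : ∀ {p s} → Prime p → p ∤ s → β (p ℕ.* s) ≡ + (p ∸ 1) * β s
β-prime-coprime {p@(suc p′)} {s} pp p∤s = begin
  β (p ℕ.* s)                   ≡⟨ β-prime-mul pp 1≤s ⟩
  + p * β s - coprimePart p s   ≡⟨ cong (λ γ → + p * β s - γ) (coprimePart-coprime p∤s 1≤s) ⟩
  (+ 1 + + p′) * β s - β s      ≡⟨ cancel (+ p′) (β s) ⟩
  + p′ * β s                    ∎
  where
  open ≡-Reasoning
  1≤s : 1 ≤ s
  1≤s = ℕₚ.n≢0⇒n>0 λ { refl → p∤s (p ∣0) }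
  cancel : ∀ q b → (+ 1 + q) * b - b ≡ q * b
  cancel = solve-∀

coprimePart-prime-power : ∀ {p} → Prime p → ∀ a → coprimePart p (p ^ a) ≡ sign a
coprimePart-prime-power {p@(suc _)} pp zero    = coprimePart-coprime p∤1 (s≤s z≤n)
  where
  p∤1 : p ∤ 1
  p∤1 p∣1 = ℕₚ.<⇒≱ (prime≥2 pp) (∣⇒≤ p∣1)
coprimePart-prime-power {p@(suc _)} pp (suc a) = begin
  coprimePart p (p ℕ.* p ^ a) ≡⟨ coprimePart-prime-mul pp (ℕₚ.m^n>0 p a) ⟩
  - coprimePart p (p ^ a)     ≡⟨ cong -_ (coprimePart-prime-power pp a) ⟩
  - sign a                    ≡⟨ sign-suc a ⟨
  sign (suc a)                ∎
  where open ≡-Reasoning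

β-prime-power : ∀ {p} → Prime p → ∀ a → β (p ^ suc a) ≡ + p * β (p ^ a) - sign a
β-prime-power {p@(suc _)} pp a =
  trans (β-prime-mul pp (ℕₚ.m^n>0 p a)) (cong (λ γ → + p * β (p ^ a) - γ) (coprimePart-prime-power pp a))

β-power-of-two : ∀ a → + 3 * β (2 ^ a) ≡ + (2 ^ suc a) + sign a
β-power-of-two zero    = refl
β-power-of-two (suc a) = begin
  + 3 * β (2 ^ suc a)
    ≡⟨ cong (_*_ (+ 3)) (β-prime-power prime[2] a) ⟩
  + 3 * (+ 2 * β (2 ^ a) - sign a)
    ≡⟨ regroup (β (2 ^ a)) (sign a) ⟩
  + 2 * (+ 3 * β (2 ^ a)) - + 3 * sign a
    ≡⟨ cong (λ t → + 2 * t - + 3 * sign a) (β-power-of-two a) ⟩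
  + 2 * (+ (2 ^ suc a) + sign a) - + 3 * sign a
    ≡⟨ collect (+ (2 ^ suc a)) (sign a) ⟩
  + 2 * + (2 ^ suc a) - sign a
    ≡⟨ cong₂ _-_ (ℤₚ.pos-* 2 (2 ^ suc a)) refl ⟨
  + (2 ^ suc (suc a)) - sign a
    ≡⟨ cong (_+_ (+ (2 ^ suc (suc a)))) (sign-suc a) ⟨
  + (2 ^ suc (suc a)) + sign (suc a) ∎
  where
  open ≡-Reasoning
  regroup : ∀ b s → + 3 * (+ 2 * b - s) ≡ + 2 * (+ 3 * b) - + 3 * s
  regroup = solve-∀
  collect : ∀ t s → + 2 * (t + s) - + 3 * s ≡ + 2 * t - s
  collect = solve-∀

-- The numbers n_k = 2^(2^k − 1).

-- β(n_k) is the m with 3·m + 1 = 2^(2^k), by the closed form and oddness of 2^k − 1.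
β-of-n : ∀ k m → 1 ≤ k → 3 ℕ.* m ℕ.+ 1 ≡ 2 ^ 2 ^ k → β (2 ^ (2 ^ k ∸ 1)) ≡ + m
β-of-n k m 1≤k 3m+1≡ = ℤₚ.*-cancelˡ-≡ (+ 3) _ _ (begin
  + 3 * β (2 ^ a)
    ≡⟨ β-power-of-two a ⟩
  + (2 ^ suc a) + sign a
    ≡⟨ cong₂ _+_ (cong (λ e → + (2 ^ e)) (ℕₚ.m+[n∸m]≡n (ℕₚ.m^n>0 2 k))) (sign-mersenne k 1≤k) ⟩
  + (2 ^ 2 ^ k) - + 1
    ≡⟨ cong (λ x → + x - + 1) 3m+1≡ ⟨
  + (3 ℕ.* m ℕ.+ 1) - + 1
    ≡⟨ cong (λ x → x - + 1) (trans (ℤₚ.pos-+ (3 ℕ.* m) 1) (cong (λ x → x + + 1) (ℤₚ.pos-* 3 m))) ⟩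
  + 3 * + m + + 1 - + 1
    ≡⟨ cancel (+ m) ⟩
  + 3 * + m ∎)
  where
  open ≡-Reasoning
  a = 2 ^ k ∸ 1
  cancel : ∀ x → + 3 * x + + 1 - + 1 ≡ + 3 * x
  cancel = solve-∀

-- A list of primes, each not dividing the product of the later ones
-- (so the primes are distinct).
data DistinctPrimes : List ℕ → Set where
  []   : DistinctPrimes []
  cons : ∀ {p ps} → Prime p → p ∤ product ps → DistinctPrimes ps → DistinctPrimes (p ∷ ps)

β-squarefree : ∀ {ps} → DistinctPrimes ps → β (product ps) ≡ + product (map (_∸ 1) ps)
β-squarefree [] = refl
β-squarefree {p ∷ ps} (cons pp p∤ps distinct) = begin
  β (p ℕ.* product ps)                    ≡⟨ β-prime-coprime pp p∤ps ⟩
  + (p ∸ 1) * β (product ps)              ≡⟨ cong (_*_ (+ (p ∸ 1))) (β-squarefree distinct) ⟩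
  + (p ∸ 1) * + product (map (_∸ 1) ps)   ≡⟨ ℤₚ.pos-* (p ∸ 1) _ ⟨
  + product (map (_∸ 1) (p ∷ ps))         ∎
  where open ≡-Reasoning

superImperfect-from-primes : ∀ k {ps} → 1 ≤ k → DistinctPrimes ps →
  3 ℕ.* product ps ℕ.+ 1 ≡ 2 ^ 2 ^ k → 2 ℕ.* product (map (_∸ 1) ps) ≡ 2 ^ (2 ^ k ∸ 1) →
  SuperImperfect (2 ^ (2 ^ k ∸ 1))
superImperfect-from-primes k {ps} 1≤k distinct 3β+1≡ 2ββ≡ = begin
  + 2 * β ℤ.∣ β (2 ^ (2 ^ k ∸ 1)) ∣
    ≡⟨ cong (λ b → + 2 * β ℤ.∣ b ∣) (β-of-n k (product ps) 1≤k 3β+1≡) ⟩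
  + 2 * β (product ps)
    ≡⟨ cong (_*_ (+ 2)) (β-squarefree distinct) ⟩
  + 2 * + product (map (_∸ 1) ps)
    ≡⟨ ℤₚ.pos-* 2 (product (map (_∸ 1) ps)) ⟨
  + (2 ℕ.* product (map (_∸ 1) ps))
    ≡⟨ cong +_ 2ββ≡ ⟩
  + (2 ^ (2 ^ k ∸ 1)) ∎
  where open ≡-Reasoning

fermatPrimes₀ : DistinctPrimes (5 ∷ [])
fermatPrimes₀ = cons (from-yes (prime? 5)) (from-no (5 ∣? 1)) []

fermatPrimes₁ : DistinctPrimes (17 ∷ 5 ∷ [])
fermatPrimes₁ = cons (from-yes (prime? 17)) (from-no (17 ∣? 5)) fermatPrimes₀

fermatPrimes₂ : DistinctPrimes (257 ∷ 17 ∷ 5 ∷ [])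
fermatPrimes₂ = cons (from-yes (prime? 257)) (from-no (257 ∣? 85)) fermatPrimes₁

fermatPrimes₃ : DistinctPrimes (65537 ∷ 257 ∷ 17 ∷ 5 ∷ [])
fermatPrimes₃ = cons (from-yes (prime? 65537)) (from-no (65537 ∣? 21845)) fermatPrimes₂

-- For 1 ≤ k ≤ 5, β(n_k) = Π_{j ≤ k−2} (2^(2^j) + 1) and n_k = 2·Π_{j ≤ k−2} 2^(2^j).
-- (The as-patterns pass k on unchanged, so that checking the result type never
-- has to evaluate β.)
superImperfect-small : ∀ k → 1 ≤ k → k ≤ 5 → SuperImperfect (2 ^ (2 ^ k ∸ 1))
superImperfect-small k@1 1≤k _ = superImperfect-from-primes k 1≤k [] refl refl
superImperfect-small k@2 1≤k _ = superImperfect-from-primes k 1≤k fermatPrimes₀ refl refl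
superImperfect-small k@3 1≤k _ = superImperfect-from-primes k 1≤k fermatPrimes₁ refl refl
superImperfect-small k@4 1≤k _ = superImperfect-from-primes k 1≤k fermatPrimes₂ refl refl
superImperfect-small k@5 1≤k _ = superImperfect-from-primes k 1≤k fermatPrimes₃ refl refl
superImperfect-small (suc (suc (suc (suc (suc (suc _)))))) _ (s≤s (s≤s (s≤s (s≤s (s≤s ())))))

prime∤power : ∀ {p m} → Prime p → p ∤ m → ∀ e → p ∤ m ^ e
prime∤power pp p∤m zero    p∣1 = ℕₚ.<⇒≱ (prime≥2 pp) (∣⇒≤ p∣1)
prime∤power {m = m} pp p∤m (suc e) p∣mᵉ⁺¹ with euclidsLemma m (m ^ e) pp p∣mᵉ⁺¹
... | inj₁ p∣m  = p∤m p∣m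
... | inj₂ p∣mᵉ = prime∤power pp p∤m e p∣mᵉ

-- For k = j + 6, β(n_k) = 641·Rⱼ, so 640 ∣ β(β(n_k)) by (i) and 5 ∣ 2·β(β(n_k));
-- but 5 does not divide the power of two n_k.
notSuperImperfect-large : ∀ j → ¬ SuperImperfect (2 ^ (2 ^ (6 ℕ.+ j) ∸ 1))
notSuperImperfect-large j si = prime∤power (from-yes (prime? 5)) (from-no (5 ∣? 2)) (2 ^ (6 ℕ.+ j) ∸ 1) 5∣n
  where
  open FermatQuotient
  open ≡-Reasoning
  n = 2 ^ (2 ^ (6 ℕ.+ j) ∸ 1)

  βn : β n ≡ + (641 ℕ.* R j)
  βn = β-of-n (6 ℕ.+ j) (641 ℕ.* R j) (s≤s z≤n)
         (trans (cong (λ y → y ℕ.+ 1) (sym (ℕₚ.*-assoc 3 641 (R j)))) (R-spec j))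

  2·640·βR≡n : + 2 * (+ 640 * β (R j)) ≡ + n
  2·640·βR≡n = begin
    + 2 * (+ 640 * β (R j))   ≡⟨ cong (_*_ (+ 2)) (β-prime-coprime prime641 (641∤R j)) ⟨
    + 2 * β (641 ℕ.* R j)     ≡⟨ cong (λ b → + 2 * β ℤ.∣ b ∣) βn ⟨
    + 2 * β ℤ.∣ β n ∣         ≡⟨ si ⟩
    + n                       ∎

  5∣n : 5 ∣ n
  5∣n = subst (5 ∣_) (begin
    2 ℕ.* (640 ℕ.* ℤ.∣ β (R j) ∣)    ≡⟨ cong (2 ℕ.*_) (ℤₚ.abs-* (+ 640) (β (R j))) ⟨
    2 ℕ.* ℤ.∣ + 640 * β (R j) ∣       ≡⟨ ℤₚ.abs-* (+ 2) (+ 640 * β (R j)) ⟨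
    ℤ.∣ + 2 * (+ 640 * β (R j)) ∣     ≡⟨ cong ℤ.∣_∣ 2·640·βR≡n ⟩
    n                                 ∎)
    (∣n⇒∣m*n 2 (∣m⇒∣m*n ℤ.∣ β (R j) ∣ (divides 128 refl)))

mainTheorem1 : (k : ℕ) → 1 ≤ k →
    (SuperImperfect (2 ^ (2 ^ k ∸ 1)) ⇔ k ≤ 5)
mainTheorem1 k 1≤k = mk⇔ onlyIf (superImperfect-small k 1≤k)
  where
  onlyIf : SuperImperfect (2 ^ (2 ^ k ∸ 1)) → k ≤ 5
  onlyIf si with k ≤? 5
  ... | yes k≤5 = k≤5
  ... | no k≰5  = contradiction (subst (λ m → SuperImperfect (2 ^ (2 ^ m ∸ 1))) k≡6+j si)
                                (notSuperImperfect-large (k ∸ 6))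
    where
    k≡6+j : k ≡ 6 ℕ.+ (k ∸ 6)
    k≡6+j = sym (ℕₚ.m+[n∸m]≡n (ℕₚ.≰⇒> k≰5))
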